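{- Let $G$ be a digraph. For any two distinct vertices $v$ and $w$ of $G$, $v\leftrightarrow_{\mathrm{2v}} w$ if and only if $v\leftrightarrow_{\mathrm{vr}} w$ and $v\leftrightarrow_{\mathrm{2e}} w$.
   Context: For distinct vertices $v,w$: $v\leftrightarrow_{\mathrm{vr}} w$ (vertex-resilient) means that for every vertex $z\notin\{v,w\}$, $v$ and $w$ lie in the same strongly connected component of $G\setminus z$; $v\leftrightarrow_{\mathrm{2v}} w$ means there are two internally vertex-disjoint directed paths from $v$ to $w$ and two internally vertex-disjoint directed paths from $w$ to $v$; $v\leftrightarrow_{\mathrm{2e}} w$ means there are two edge-disjoint directed paths from $v$ to $w$ and two edge-disjoint directed paths from $w$ to $v$. -}

module Defs where

open import Data.Nat using (ℕ)
open import Data.Fin using (Fin)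
open import Data.List using (List; []; _∷_)
open import Data.List.Membership.Propositional using (_∈_; _∉_)
open import Data.List.Relation.Unary.Unique.Propositional using (Unique)
open import Data.Product using (Σ; _×_; _,_)
open import Data.Sum using (_⊎_)
open import Data.Empty using (⊥)
open import Relation.Nullary using (¬_)
open import Relation.Binary.PropositionalEquality using (_≡_; _≢_)

Digraph : ℕ → Set₁
Digraph n = Fin n → Fin n → Set

module _ {n : ℕ} (G : Digraph n) where

  data Walk : Fin n → Fin n → List (Fin n) → Set where
    stop : ∀ {x} → Walk x x (x ∷ [])
    step : ∀ {x y z xs} → G x y → Walk y z xs → Walk x z (x ∷ xs)

  IsPath : Fin n → Fin n → List (Fin n) → Set
  IsPath x y xs = Walk x y xs × Unique xs

edgesOf : ∀ {n} → List (Fin n) → List (Fin n × Fin n)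
edgesOf []           = []
edgesOf (x ∷ [])     = []
edgesOf (x ∷ y ∷ xs) = (x , y) ∷ edgesOf (y ∷ xs)

module _ {n : ℕ} (G : Digraph n) where

  TwoInternallyDisjointPaths : Fin n → Fin n → Set
  TwoInternallyDisjointPaths v w =
    Σ (List (Fin n)) λ P → Σ (List (Fin n)) λ Q →
      IsPath G v w P × IsPath G v w Q × P ≢ Q ×
      (∀ u → u ∈ P → u ∈ Q → u ≡ v ⊎ u ≡ w)

  TwoEdgeDisjointPaths : Fin n → Fin n → Set
  TwoEdgeDisjointPaths v w =
    Σ (List (Fin n)) λ P → Σ (List (Fin n)) λ Q →
      IsPath G v w P × IsPath G v w Q ×
      (∀ e → e ∈ edgesOf P → e ∈ edgesOf Q → ⊥)

  ReachAvoiding : Fin n → Fin n → Fin n → Set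
  ReachAvoiding z v w =
    Σ (List (Fin n)) λ P → IsPath G v w P × z ∉ P

  SameSCCWithout : Fin n → Fin n → Fin n → Set
  SameSCCWithout z v w = ReachAvoiding z v w × ReachAvoiding z w v

  VertexResilient : Fin n → Fin n → Set
  VertexResilient v w = ∀ z → z ≢ v → z ≢ w → SameSCCWithout z v w

  TwoVertexConnected : Fin n → Fin n → Set
  TwoVertexConnected v w =
    TwoInternallyDisjointPaths v w × TwoInternallyDisjointPaths w v

  TwoEdgeConnected : Fin n → Fin n → Set
  TwoEdgeConnected v w = TwoEdgeDisjointPaths v w × TwoEdgeDisjointPaths w v

module Submission where

-- It suffices to treat one direction v ⇝ w.  Two internally disjoint paths
-- are edge-disjoint, and deleting a third vertex z destroys at most one of
-- them; this gives the easy implication.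
--
-- For the converse (a two-path Menger theorem) fix a v-w path P.  If P is
-- the single edge v → w, an edge-disjoint second path is already internally
-- disjoint from it.  Otherwise the proof walks along P, maintaining a Frame
-- at a vertex p of P: two paths X, Y from v to p meeting only in v and p,
-- both avoiding the part N of P after p (initially X = Y = v → p₁).  To
-- advance, take a path from v to w avoiding p and its segment from its last
-- vertex u on X ∪ Y to its first vertex t on N.  If u lies on Y, the new
-- frame at t consists of Y up to u followed by that segment, and X followed
-- by P from p to t (symmetrically if u lies on X); these differ, as only the
-- second passes through p.  At p = w the frame is the required pair of paths.

open import Defs
open import Data.Nat using (ℕ; _<_)
open import Data.Nat.Properties using (n<1+n; m<n⇒m<1+n)
open import Data.Nat.Induction using (<-wellFounded)
open import Induction.WellFounded using (Acc; acc)
open import Data.Fin using (Fin)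
open import Data.Fin.Properties using (_≟_)
open import Data.Product as Product using (Σ; _×_; _,_; proj₁; proj₂)
open import Data.Sum using (_⊎_; inj₁; inj₂; [_,_]′)
open import Data.Empty using (⊥; ⊥-elim)
open import Data.List using (List; []; _∷_; _++_; length)
open import Data.List.Membership.Propositional using (_∈_; _∉_)
open import Data.List.Membership.Propositional.Properties using (∈-++⁺ˡ; ∈-++⁺ʳ; ∈-++⁻)
import Data.List.Membership.DecPropositional as DecMembership
open import Data.List.Relation.Unary.Any using (here; there)
open import Data.List.Relation.Unary.All as All using ([]; _∷_)
open import Data.List.Relation.Unary.All.Properties using (¬Any⇒All¬; ++⁻ˡ; ++⁻ʳ)
open import Data.List.Relation.Unary.AllPairs as AllPairs using ([]; _∷_)
open import Data.List.Relation.Unary.Unique.Propositional using (Unique)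
open import Data.List.Relation.Unary.Unique.Propositional.Properties
  using (Unique[x∷xs]⇒x∉xs) renaming (++⁺ to unique-++⁺)
open import Data.List.Relation.Binary.Disjoint.Propositional using (Disjoint)
open import Data.List.Relation.Binary.Subset.Propositional using (_⊆_)
open import Data.List.Relation.Binary.Subset.Propositional.Properties as Subset
  using (∷⁺ʳ)
open import Relation.Nullary using (yes; no; Dec)
open import Function using (_∘_; case_of_)
open import Function.Bundles using (_⇔_; mk⇔)
open import Relation.Binary.PropositionalEquality using (_≡_; _≢_; refl; sym; trans; subst)

private
  variable
    n : ℕ
    G : Digraph n
    a b u x y z : Fin n
    xs ys : List (Fin n)

_∈?_ : (x : Fin n) (xs : List (Fin n)) → Dec (x ∈ xs)
x ∈? xs = DecMembership._∈?_ _≟_ x xs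

unique-++⁻ : ∀ {A : Set} (xs : List A) {ys} →
             Unique (xs ++ ys) → Unique xs × Unique ys × Disjoint xs ys
unique-++⁻ [] uniq = [] , uniq , λ ()
unique-++⁻ (x ∷ xs) (x∉ ∷ uniq) with unique-++⁻ xs uniq
... | xs! , ys! , xs#ys = ++⁻ˡ xs x∉ ∷ xs! , ys! , disjoint
  where
  disjoint : Disjoint (x ∷ xs) _
  disjoint (here refl , z∈ys) = All.lookup (++⁻ʳ xs x∉) z∈ys refl
  disjoint (there z∈xs , z∈ys) = xs#ys (z∈xs , z∈ys)

prefix⊆ : ∀ (pre : List (Fin n)) → pre ++ u ∷ [] ⊆ pre ++ u ∷ ys
prefix⊆ pre = Subset.++⁺ʳ pre (∷⁺ʳ _ λ ())

prefix-unique : ∀ (pre : List (Fin n)) → Unique (pre ++ u ∷ ys) → Unique (pre ++ u ∷ [])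
prefix-unique pre uniq with unique-++⁻ pre uniq
... | pre! , _ , pre#rest =
  unique-++⁺ pre! ([] ∷ []) λ { (z∈pre , here refl) → pre#rest (z∈pre , here refl) }

length-suffix : ∀ {A : Set} (xs : List A) {y} ys → length ys < length (xs ++ y ∷ ys)
length-suffix [] ys = n<1+n (length ys)
length-suffix (_ ∷ xs) ys = m<n⇒m<1+n (length-suffix xs ys)


source∈ : Walk G x y xs → x ∈ xs
source∈ stop = here refl
source∈ (step _ _) = here refl

target∈ : Walk G x y xs → y ∈ xs
target∈ stop = here refl
target∈ (step _ q) = there (target∈ q)

_▸_ : Walk G x y xs → Walk G y z (y ∷ ys) → Walk G x z (xs ++ ys)
stop ▸ q = q
step e p ▸ q = step e (p ▸ q)

distinct-ends : IsPath G x y (x ∷ z ∷ xs) → x ≢ y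
distinct-ends (step _ q , x∉ ∷ _) refl = All.lookup x∉ (target∈ q) refl

record Cut (G : Digraph n) (x y u : Fin n) (xs : List (Fin n)) : Set where
  constructor cut
  field
    pre suf : List (Fin n)
    splits  : xs ≡ pre ++ u ∷ suf
    before  : Walk G x u (pre ++ u ∷ [])
    after   : Walk G u y (u ∷ suf)

cutAt : Walk G x y xs → u ∈ xs → Cut G x y u xs
cutAt stop (here refl) = cut [] [] refl stop stop
cutAt (step e q) (here refl) = cut [] _ refl stop (step e q)
cutAt (step e q) (there u∈) with cutAt q u∈
... | cut pre suf refl before after = cut (_ ∷ pre) suf refl (step e before) after

target∉before : Unique xs → (c : Cut G x y u xs) → u ≢ y → y ∉ Cut.pre c ++ u ∷ []
target∉before uniq (cut pre suf refl _ after) u≢y y∈ with ∈-++⁻ pre y∈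
... | inj₁ y∈pre = proj₂ (proj₂ (unique-++⁻ pre uniq)) (y∈pre , target∈ after)
... | inj₂ (here refl) = u≢y refl

shortcut : Walk G x y xs → Σ (List (Fin n)) λ ys → IsPath G x y ys × ys ⊆ xs
shortcut {x = x} stop = x ∷ [] , (stop , [] ∷ []) , λ z∈ → z∈
shortcut {x = x} (step e q) with shortcut q
... | ys , (path , ys!) , ys⊆ with x ∈? ys
...   | no x∉ys = x ∷ ys , (step e path , ¬Any⇒All¬ ys x∉ys ∷ ys!) , ∷⁺ʳ x ys⊆
...   | yes x∈ys with cutAt path x∈ys
...     | cut pre suf refl _ after =
  x ∷ suf , (after , proj₁ (proj₂ (unique-++⁻ pre ys!))) ,
  λ z∈ → there (ys⊆ (∈-++⁺ʳ pre z∈))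

record Crossing (G : Digraph n) (A N xs : List (Fin n)) : Set where
  field
    start end : Fin n
    inner     : List (Fin n)
    walk      : Walk G start end (start ∷ inner)
    start∈A   : start ∈ A
    end∈N     : end ∈ N
    within    : start ∷ inner ⊆ xs
    onlyStart : ∀ {z} → z ∈ start ∷ inner → z ∈ A → z ≡ start
    onlyEnd   : ∀ {z} → z ∈ start ∷ inner → z ∈ N → z ≡ end

crossing : ∀ {A N} → Disjoint A N → Walk G x y xs → x ∈ A → y ∈ N → Crossing G A N xs
crossing A#N stop x∈A x∈N = ⊥-elim (A#N (x∈A , x∈N))
crossing {G = G} {x = x} {A = A} {N} A#N (step {y = x′} {xs = tail} e q) x∈A y∈N with x′ ∈? N
... | yes x′∈N = record
  { start = x ; end = x′ ; inner = x′ ∷ [] ; walk = step e stop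
  ; start∈A = x∈A ; end∈N = x′∈N
  ; within = λ { (here refl) → here refl ; (there (here refl)) → there (source∈ q) }
  ; onlyStart = λ { (here refl) _ → refl ; (there (here refl)) z∈A → ⊥-elim (A#N (z∈A , x′∈N)) }
  ; onlyEnd = λ { (here refl) z∈N → ⊥-elim (A#N (x∈A , z∈N)) ; (there (here refl)) _ → refl } }
... | no x′∉N with x′ ∈? A
...   | yes x′∈A = later (crossing A#N q x′∈A y∈N)
  where
  later : Crossing G A N tail → Crossing G A N (x ∷ tail)
  later c = record { Crossing c hiding (within) ; within = there ∘ Crossing.within c }
...   | no x′∉A = extend (crossing x′A#N q (here refl) y∈N)
  where
  x′A#N : Disjoint (x′ ∷ A) N
  x′A#N (here refl , z∈N) = x′∉N z∈N
  x′A#N (there z∈A , z∈N) = A#N (z∈A , z∈N)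
  -- a crossing from x′ ∷ A either starts in A, or at x′ and extends back to x
  extend : Crossing G (x′ ∷ A) N tail → Crossing G A N (x ∷ tail)
  extend c with Crossing.start∈A c
  ... | there s∈A = record
    { Crossing c hiding (start∈A; within; onlyStart)
    ; start∈A = s∈A ; within = there ∘ within ; onlyStart = λ z∈ z∈A → onlyStart z∈ (there z∈A) }
    where open Crossing c
  ... | here refl = record
    { start = x ; end = end ; inner = start ∷ inner ; walk = step e walk ; start∈A = x∈A
    ; end∈N = end∈N ; within = ∷⁺ʳ x within
    ; onlyStart = λ { (here refl) _ → refl
                    ; (there z∈) z∈A → ⊥-elim (x′∉A (subst (_∈ A) (onlyStart z∈ (there z∈A)) z∈A)) }
    ; onlyEnd = λ { (here refl) z∈N → ⊥-elim (A#N (x∈A , z∈N)) ; (there z∈) → onlyEnd z∈ } }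
    where open Crossing c


edge-ends : ∀ (xs : List (Fin n)) → (a , b) ∈ edgesOf xs → a ∈ xs × b ∈ xs
edge-ends (x ∷ y ∷ xs) (here refl) = here refl , there (here refl)
edge-ends (x ∷ y ∷ xs) (there e) = Product.map there there (edge-ends (y ∷ xs) e)

no-loop : ∀ (xs : List (Fin n)) → Unique xs → (a , a) ∉ edgesOf xs
no-loop (x ∷ y ∷ xs) (x∉ ∷ _) (here refl) = All.head x∉ refl
no-loop (x ∷ y ∷ xs) (_ ∷ uniq) (there e) = no-loop (y ∷ xs) uniq e

no-edge-from-target : IsPath G x y xs → (y , b) ∉ edgesOf xs
no-edge-from-target (step _ stop , x∉ ∷ _) (here refl) = All.head x∉ refl
no-edge-from-target (step _ stop , _) (there ())
no-edge-from-target (step _ q@(step _ _) , x∉ ∷ _) (here refl) = All.lookup x∉ (target∈ q) refl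
no-edge-from-target (step _ q@(step _ _) , _ ∷ uniq) (there e) = no-edge-from-target (q , uniq) e

direct-edge : IsPath G x y xs → (x , y) ∈ edgesOf xs → xs ≡ x ∷ y ∷ []
direct-edge (step _ stop , _) (here refl) = refl
direct-edge (step _ (step _ q) , _ ∷ y∉ ∷ _) (here refl) = ⊥-elim (All.lookup y∉ (target∈ q) refl)
direct-edge {xs = _ ∷ y ∷ xs} (step _ (step _ _) , x∉ ∷ _) (there e) =
  ⊥-elim (All.lookup x∉ (proj₁ (edge-ends (y ∷ xs) e)) refl)


disjoint⇒avoiding : ∀ {v w} → TwoInternallyDisjointPaths G v w →
                    ∀ z → z ≢ v → z ≢ w → ReachAvoiding G z v w
disjoint⇒avoiding (P , Q , P-path , Q-path , _ , P∩Q) z z≢v z≢w with z ∈? P | z ∈? Q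
... | no z∉P | _ = P , P-path , z∉P
... | yes _ | no z∉Q = Q , Q-path , z∉Q
... | yes z∈P | yes z∈Q = ⊥-elim ([ z≢v , z≢w ]′ (P∩Q z z∈P z∈Q))

-- A common edge would join two of {v, w}: a loop, an edge out of w, or the
-- edge v → w, which forces both paths to be that single edge.
disjoint⇒edgeDisjoint : ∀ {v w} → TwoInternallyDisjointPaths G v w → TwoEdgeDisjointPaths G v w
disjoint⇒edgeDisjoint (P , Q , P-path , Q-path , P≢Q , P∩Q) =
  P , Q , P-path , Q-path , shared
  where
  shared : ∀ e → e ∈ edgesOf P → e ∈ edgesOf Q → ⊥
  shared (a , b) eP eQ
    with P∩Q a (proj₁ (edge-ends P eP)) (proj₁ (edge-ends Q eQ))
       | P∩Q b (proj₂ (edge-ends P eP)) (proj₂ (edge-ends Q eQ))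
  ... | inj₂ refl | _ = no-edge-from-target P-path eP
  ... | inj₁ refl | inj₁ refl = no-loop P (proj₂ P-path) eP
  ... | inj₁ refl | inj₂ refl = P≢Q (trans (direct-edge P-path eP) (sym (direct-edge Q-path eQ)))


module Menger (G : Digraph n) (v w : Fin n)
  (detour : ∀ z → z ≢ v → z ≢ w → ReachAvoiding G z v w) where

  record Frame (p : Fin n) (N : List (Fin n)) : Set where
    field
      X Y      : List (Fin n)
      X-path   : IsPath G v p X
      Y-path   : IsPath G v p Y
      X∩Y      : ∀ {z} → z ∈ X → z ∈ Y → z ≡ v ⊎ z ≡ p
      X#N      : Disjoint X N
      Y#N      : Disjoint Y N
      rest     : IsPath G p w (p ∷ N)
      p≢v      : p ≢ v
      distinct : N ≡ [] → X ≢ Y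

  swap : ∀ {p N} → Frame p N → Frame p N
  swap fr = record
    { X = Y ; Y = X ; X-path = Y-path ; Y-path = X-path ; X∩Y = λ z∈Y z∈X → X∩Y z∈X z∈Y
    ; X#N = Y#N ; Y#N = X#N ; rest = rest ; p≢v = p≢v ; distinct = λ N≡[] → distinct N≡[] ∘ sym }
    where open Frame fr

  finish : ∀ {p} → Frame p [] → TwoInternallyDisjointPaths G v w
  finish fr with Frame.rest fr
  ... | stop , _ = X , Y , X-path , Y-path , distinct refl , λ _ → X∩Y
    where open Frame fr

  Advance : List (Fin n) → Set
  Advance N = Σ (Fin n) λ t → Σ (List (Fin n)) λ N′ → Frame t N′ × length N′ < length N

  module Reroute {p u t bridge N₁ N₂} (fr : Frame p (N₁ ++ t ∷ N₂))
    (toT : Walk G p t (p ∷ N₁ ++ t ∷ [])) (fromT : Walk G t w (t ∷ N₂))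
    (u∈Y : u ∈ Frame.Y fr) (walk : Walk G u t (u ∷ bridge))
    (bridge∩X : ∀ {z} → z ∈ u ∷ bridge → z ∈ Frame.X fr → z ≡ u)
    (bridge∩N : ∀ {z} → z ∈ u ∷ bridge → z ∈ N₁ ++ t ∷ N₂ → z ≡ t)
    (p∉bridge : p ∉ u ∷ bridge) where

    open Frame fr

    N₁#N₂ : Disjoint N₁ N₂
    N₁#N₂ (z∈N₁ , z∈N₂) = proj₂ (proj₂ (unique-++⁻ N₁ (AllPairs.tail (proj₂ rest)))) (z∈N₁ , there z∈N₂)

    t∷N₂-unique : Unique (t ∷ N₂)
    t∷N₂-unique = proj₁ (proj₂ (unique-++⁻ N₁ (AllPairs.tail (proj₂ rest))))

    N₁t⊆N : N₁ ++ t ∷ [] ⊆ N₁ ++ t ∷ N₂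
    N₁t⊆N = prefix⊆ N₁

    N₂⊆N : N₂ ⊆ N₁ ++ t ∷ N₂
    N₂⊆N = ∈-++⁺ʳ N₁ ∘ there

    -- Y up to u; it avoids p, which is the end of Y and not u
    toU : Cut G v p u Y
    toU = cutAt (proj₁ Y-path) u∈Y

    front : List (Fin n)
    front = Cut.pre toU ++ u ∷ []

    front⊆Y : front ⊆ Y
    front⊆Y = subst (front ⊆_) (sym (Cut.splits toU)) (prefix⊆ (Cut.pre toU))

    p∉front : p ∉ front
    p∉front = target∉before (proj₂ Y-path) toU (λ u≡p → p∉bridge (here (sym u≡p)))

    X′-route : Σ (List (Fin n)) λ X′ → IsPath G v t X′ × X′ ⊆ front ++ bridge
    X′-route = shortcut (Cut.before toU ▸ walk)

    X′ : List (Fin n)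
    X′ = proj₁ X′-route

    X′-cases : ∀ {z} → z ∈ X′ → z ∈ front ⊎ z ∈ u ∷ bridge
    X′-cases z∈ with ∈-++⁻ front (proj₂ (proj₂ X′-route) z∈)
    ... | inj₁ z∈front = inj₁ z∈front
    ... | inj₂ z∈bridge = inj₂ (there z∈bridge)

    Y′ : List (Fin n)
    Y′ = X ++ N₁ ++ t ∷ []

    Y′-path : IsPath G v t Y′
    Y′-path = proj₁ X-path ▸ toT ,
      unique-++⁺ (proj₂ X-path) (AllPairs.tail (prefix-unique (p ∷ N₁) (proj₂ rest)))
                 (λ (z∈X , z∈N₁t) → X#N (z∈X , N₁t⊆N z∈N₁t))

    meet : ∀ {z} → z ∈ X′ → z ∈ Y′ → z ≡ v ⊎ z ≡ t
    meet z∈X′ z∈Y′ with X′-cases z∈X′ | ∈-++⁻ X z∈Y′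
    ... | inj₁ z∈front | inj₁ z∈X =
      [ inj₁ , (λ { refl → ⊥-elim (p∉front z∈front) }) ]′ (X∩Y z∈X (front⊆Y z∈front))
    ... | inj₁ z∈front | inj₂ z∈N₁t = ⊥-elim (Y#N (front⊆Y z∈front , N₁t⊆N z∈N₁t))
    ... | inj₂ z∈bridge | inj₂ z∈N₁t = inj₂ (bridge∩N z∈bridge (N₁t⊆N z∈N₁t))
    ... | inj₂ z∈bridge | inj₁ z∈X with bridge∩X z∈bridge z∈X
    ...   | refl = [ inj₁ , (λ { refl → ⊥-elim (p∉bridge (here refl)) }) ]′
                     (X∩Y z∈X (front⊆Y (∈-++⁺ʳ (Cut.pre toU) (here refl))))

    X′#N₂ : Disjoint X′ N₂
    X′#N₂ (z∈X′ , z∈N₂) with X′-cases z∈X′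
    ... | inj₁ z∈front = Y#N (front⊆Y z∈front , N₂⊆N z∈N₂)
    ... | inj₂ z∈bridge with bridge∩N z∈bridge (N₂⊆N z∈N₂)
    ...   | refl = Unique[x∷xs]⇒x∉xs t∷N₂-unique z∈N₂

    Y′#N₂ : Disjoint Y′ N₂
    Y′#N₂ (z∈Y′ , z∈N₂) with ∈-++⁻ X z∈Y′
    ... | inj₁ z∈X = X#N (z∈X , N₂⊆N z∈N₂)
    ... | inj₂ z∈N₁t with ∈-++⁻ N₁ z∈N₁t
    ...   | inj₁ z∈N₁ = N₁#N₂ (z∈N₁ , z∈N₂)
    ...   | inj₂ (here refl) = Unique[x∷xs]⇒x∉xs t∷N₂-unique z∈N₂

    -- p lies on Y′ but not on X′
    X′≢Y′ : X′ ≢ Y′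
    X′≢Y′ X′≡Y′ with X′-cases (subst (p ∈_) (sym X′≡Y′) (∈-++⁺ˡ (target∈ (proj₁ X-path))))
    ... | inj₁ p∈front = p∉front p∈front
    ... | inj₂ p∈bridge = p∉bridge p∈bridge

    frame : Frame t N₂
    frame = record
      { X = X′ ; Y = Y′ ; X-path = proj₁ (proj₂ X′-route) ; Y-path = Y′-path
      ; X∩Y = meet ; X#N = X′#N₂ ; Y#N = Y′#N₂
      ; rest = fromT , t∷N₂-unique
      ; p≢v = λ { refl → X#N (source∈ (proj₁ X-path) , ∈-++⁺ʳ N₁ (here refl)) }
      ; distinct = λ _ → X′≢Y′ }

  reroute : ∀ {p N u t bridge} (fr : Frame p N) → u ∈ Frame.Y fr →
            Walk G u t (u ∷ bridge) → t ∈ N →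
            (∀ {z} → z ∈ u ∷ bridge → z ∈ Frame.X fr → z ≡ u) →
            (∀ {z} → z ∈ u ∷ bridge → z ∈ N → z ≡ t) →
            p ∉ u ∷ bridge → Advance N
  reroute fr u∈Y walk t∈N bridge∩X bridge∩N p∉bridge
    with cutAt (proj₁ (Frame.rest fr)) (there t∈N)
  ... | cut [] _ refl _ _ = ⊥-elim (p∉bridge (target∈ walk))
  ... | cut (_ ∷ N₁) N₂ refl toT fromT =
    _ , N₂ , Reroute.frame fr toT fromT u∈Y walk bridge∩X bridge∩N p∉bridge , length-suffix N₁ N₂

  -- One step: the detour avoiding p crosses from X ∪ Y into N; its crossing
  -- is a bridge for the frame, or for the frame with X and Y swapped.
  advance : ∀ {p m N} → Frame p (m ∷ N) → Advance (m ∷ N)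
  advance {p} {m} {N} fr = via (detour p p≢v p≢w)
    where
    open Frame fr
    p≢w : p ≢ w
    p≢w = distinct-ends rest
    X∪Y#N : Disjoint (X ++ Y) (m ∷ N)
    X∪Y#N (z∈X∪Y , z∈N) = [ (λ z∈X → X#N (z∈X , z∈N)) , (λ z∈Y → Y#N (z∈Y , z∈N)) ]′ (∈-++⁻ X z∈X∪Y)
    v∈X∪Y : v ∈ X ++ Y
    v∈X∪Y = ∈-++⁺ˡ (source∈ (proj₁ X-path))
    w∈N : w ∈ m ∷ N
    w∈N with target∈ (proj₁ rest)
    ... | here w≡p = ⊥-elim (p≢w (sym w≡p))
    ... | there w∈N = w∈N
    via : ReachAvoiding G p v w → Advance (m ∷ N)
    via (R , (R-walk , _) , p∉R) = [ fromX , fromY ]′ (∈-++⁻ X start∈A)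
      where
      open Crossing (crossing X∪Y#N R-walk v∈X∪Y w∈N)
      fromX : start ∈ X → Advance (m ∷ N)
      fromX u∈X = reroute (swap fr) u∈X walk end∈N (λ z∈ z∈Y → onlyStart z∈ (∈-++⁺ʳ X z∈Y))
                    onlyEnd (p∉R ∘ within)
      fromY : start ∈ Y → Advance (m ∷ N)
      fromY u∈Y = reroute fr u∈Y walk end∈N (λ z∈ z∈X → onlyStart z∈ (∈-++⁺ˡ z∈X))
                    onlyEnd (p∉R ∘ within)

  run : ∀ {p N} → Acc _<_ (length N) → Frame p N → TwoInternallyDisjointPaths G v w
  run {N = []} _ fr = finish fr
  run {N = _ ∷ _} (acc further) fr with advance fr
  ... | _ , _ , fr′ , shorter = run (further shorter) fr′

  -- Start with a v-w path P and an edge-disjoint one Q (used only if P is one edge).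
  disjointPaths : v ≢ w → TwoEdgeDisjointPaths G v w → TwoInternallyDisjointPaths G v w
  disjointPaths v≢w (P , Q , P-path , Q-path , P#Q) with P-path
  ... | stop , _ = ⊥-elim (v≢w refl)
  ... | step e stop , P! = P , Q , P-path , Q-path , P≢Q , ends
    where
    P≢Q : P ≢ Q
    P≢Q refl = P#Q (v , w) (here refl) (here refl)
    ends : ∀ z → z ∈ P → z ∈ Q → z ≡ v ⊎ z ≡ w
    ends z (here z≡v) _ = inj₁ z≡v
    ends z (there (here z≡w)) _ = inj₂ z≡w
  ... | step {y = p} e (step e′ q) , v∉ ∷ p∉ ∷ rest! = run (<-wellFounded _) start
    where
    [v,p]-path : IsPath G v p (v ∷ p ∷ [])
    [v,p]-path = step e stop , (All.head v∉ ∷ []) ∷ [] ∷ []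
    [v,p]#N : Disjoint (v ∷ p ∷ []) _
    [v,p]#N (here refl , z∈N) = All.lookup (All.tail v∉) z∈N refl
    [v,p]#N (there (here refl) , z∈N) = All.lookup p∉ z∈N refl
    start : Frame p _
    start = record
      { X = v ∷ p ∷ [] ; Y = v ∷ p ∷ [] ; X-path = [v,p]-path ; Y-path = [v,p]-path
      ; X∩Y = λ { (here z≡v) _ → inj₁ z≡v ; (there (here z≡p)) _ → inj₂ z≡p }
      ; X#N = [v,p]#N ; Y#N = [v,p]#N
      ; rest = step e′ q , p∉ ∷ rest!
      ; p≢v = All.head v∉ ∘ sym
      ; distinct = λ { refl → case source∈ q of λ () } }


corollary2 : ∀ {n : ℕ} (G : Digraph n) (v w : Fin n) → v ≢ w →
    TwoVertexConnected G v w ⇔ (VertexResilient G v w × TwoEdgeConnected G v w)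
corollary2 G v w v≢w = mk⇔
  (λ (vw , wv) →
     (λ z z≢v z≢w → disjoint⇒avoiding vw z z≢v z≢w , disjoint⇒avoiding wv z z≢w z≢v) ,
     disjoint⇒edgeDisjoint vw , disjoint⇒edgeDisjoint wv)
  (λ (resilient , vw , wv) →
     Menger.disjointPaths G v w (λ z z≢v z≢w → proj₁ (resilient z z≢v z≢w)) v≢w vw ,
     Menger.disjointPaths G w v (λ z z≢w z≢v → proj₂ (resilient z z≢v z≢w)) (v≢w ∘ sym) wv)
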